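{- Let $s\ge 3$ be odd. There is no bipartite biregular graph with degrees $2s$ and $s$ and diameter $3$ whose order equals $M(2s,s;3)=3\left\lfloor\frac{1+s(2s-1)}{2}\right\rfloor$.
   Context: A bipartite graph with stable sets $V_1,V_2$ is biregular with degrees $r,s$ if all vertices of $V_1$ have degree $r$ and all vertices of $V_2$ have degree $s$. For $r>s$, the Moore-like bound for diameter $3$ is $M(r,s;3)=\lfloor (1+s(r-1))/\rho\rfloor(\rho+\sigma)$ with $\rho=r/\gcd\{r,s\}$, $\sigma=s/\gcd\{r,s\}$; for $r=2s$ this is the expression given in the claim. A graph attaining this bound is called a bimoore graph. -}

module Defs where

open import Data.Nat using (ℕ; zero; suc; _≤_; _∸_)
open import Data.Bool using (Bool; true; false; if_then_else_)
open import Data.Fin using (Fin)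
open import Data.List using (List; map; allFin)
open import Data.Nat.ListAction using (sum)
open import Data.Product using (Σ; _×_; ∃; ∃-syntax)
open import Data.Sum using (_⊎_)
open import Relation.Binary.PropositionalEquality using (_≡_; _≢_)
open import Relation.Nullary using (¬_)

Adj : ℕ → Set
Adj n = Fin n → Fin n → Bool

IsSimple : ∀ {n} → Adj n → Set
IsSimple {n} A = (∀ u v → A u v ≡ A v u) × (∀ u → A u u ≡ false)

degree : ∀ {n} → Adj n → Fin n → ℕ
degree {n} A v = sum (map (λ w → if A v w then 1 else 0) (allFin n))

IsBiregular : ∀ {n} → Adj n → ℕ → ℕ → Set
IsBiregular {n} A r s =
  Σ (Fin n → Bool) λ part →
      (∀ u v → A u v ≡ true → part u ≢ part v)
    × (∀ v → part v ≡ true → degree A v ≡ r)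
    × (∀ v → part v ≡ false → degree A v ≡ s)

data Walk {n} (A : Adj n) : ℕ → Fin n → Fin n → Set where
  here : ∀ {u} → Walk A 0 u u
  step : ∀ {k u w v} → A u w ≡ true → Walk A k w v → Walk A (suc k) u v

DistLe : ∀ {n} → Adj n → ℕ → Fin n → Fin n → Set
DistLe A k u v = ∃[ m ] (m ≤ k × Walk A m u v)

HasDiameter : ∀ {n} → Adj n → ℕ → Set
HasDiameter {n} A d =
    (∀ u v → DistLe A d u v)
  × (d ≡ 0 ⊎ ∃[ u ] ∃[ v ] ¬ DistLe A (d ∸ 1) u v)

module Submission where

-- Let V₁, V₂ be the sides of degrees 2s and s. Counting edges gives |V₂| = 2|V₁|, so the
-- order 3M forces |V₁| = M and |V₂| = 2M = 2s² − s + 1. From p ∈ V₂ there are 2s² walks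
-- of length two, all ending in V₂; s of them return to p, and by diameter 3 each of the
-- other 2M − 1 = 2s² − s vertices of V₂ is reached at least once, hence exactly once.
-- So two vertices of V₂ have exactly one common neighbour, and two vertices of V₁ at most
-- one. Since |V₁| = M > s, some B ∈ V₁ is not adjacent to p. Each of the 2s neighbours q
-- of B is reached from p by a unique path p C q, and distinct q need distinct C (else B
-- and C would share two neighbours), so 2s ≤ deg p = s.

open import Defs
open import Data.Nat using (ℕ; zero; suc; _≤_; _<_; _+_; _*_; _∸_; _/_; _%_; z≤n; s≤s; NonZero; >-nonZero)
open import Data.Nat.Properties
open import Data.Nat.DivMod using (m≡m%n+[m/n]*n; m*n/n≡m)
open import Data.Nat.Tactic.RingSolver using (solve-∀)
open import Data.Nat.ListAction using (sum)
open import Data.Bool using (Bool; true; false; not; _∧_; if_then_else_)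
open import Data.Bool.Properties using (not-injective; ¬-not)
open import Data.Fin using (Fin; zero; suc) renaming (_≟_ to _≟ᶠ_)
import Data.Fin.Properties as Fin
open import Data.List using (tabulate)
open import Data.List.Properties using (map-tabulate)
open import Data.Product using (_×_; _,_; proj₁; proj₂; ∃-syntax)
open import Data.Empty using (⊥-elim)
open import Function using (_∘_)
open import Relation.Binary.PropositionalEquality
  using (_≡_; _≢_; refl; sym; trans; cong; cong₂; subst; module ≡-Reasoning)
open import Relation.Nullary using (¬_; yes; no)
open import Algebra.Properties.Semiring.Sum +-*-semiring
  using (sum-syntax; sum-cong-≗; ∑-distrib-+; ∑-comm; *-distribˡ-sum; *-distribʳ-sum)
  renaming (sum to ∑)

∑-const : ∀ {n} c → ∑ {n} (λ _ → c) ≡ n * c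
∑-const {zero} c = refl
∑-const {suc n} c = cong (c +_) (∑-const {n} c)

∑-zero : ∀ {n} → ∑ {n} (λ _ → 0) ≡ 0
∑-zero {n} = trans (∑-const {n} 0) (*-zeroʳ n)

∑-mono-≤ : ∀ {n} {f g : Fin n → ℕ} → (∀ i → f i ≤ g i) → ∑ f ≤ ∑ g
∑-mono-≤ {zero} f≤g = z≤n
∑-mono-≤ {suc n} f≤g = +-mono-≤ (f≤g zero) (∑-mono-≤ (f≤g ∘ suc))

∑-mono-< : ∀ {n} {f g : Fin n → ℕ} → (∀ j → f j ≤ g j) → ∀ i → f i < g i → ∑ f < ∑ g
∑-mono-< f≤g zero fi<gi = +-mono-<-≤ fi<gi (∑-mono-≤ (f≤g ∘ suc))
∑-mono-< f≤g (suc i) fi<gi = +-mono-≤-< (f≤g zero) (∑-mono-< (f≤g ∘ suc) i fi<gi)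

∑-mono-≤-rigid : ∀ {n} {f g : Fin n → ℕ} → (∀ i → f i ≤ g i) → ∑ g ≤ ∑ f → ∀ i → f i ≡ g i
∑-mono-≤-rigid {f = f} {g} f≤g ∑g≤∑f i with f i ≟ g i
... | yes fi≡gi = fi≡gi
... | no fi≢gi = ⊥-elim (<⇒≱ (∑-mono-< f≤g i (≤∧≢⇒< (f≤g i) fi≢gi)) ∑g≤∑f)

∑<∑⇒∃< : ∀ {n} (f g : Fin n → ℕ) → ∑ f < ∑ g → ∃[ i ] f i < g i
∑<∑⇒∃< {suc n} f g ∑f<∑g with f zero <? g zero
... | yes f0<g0 = zero , f0<g0
... | no f0≮g0 with ∑<∑⇒∃< (f ∘ suc) (g ∘ suc)
                     (+-cancelˡ-< (g zero) _ _ (≤-<-trans (+-monoˡ-≤ _ (≮⇒≥ f0≮g0)) ∑f<∑g))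
...   | i , fi<gi = suc i , fi<gi

term≤∑ : ∀ {n} (f : Fin n → ℕ) i → f i ≤ ∑ f
term≤∑ f zero = m≤m+n _ _
term≤∑ f (suc i) = ≤-trans (term≤∑ (f ∘ suc) i) (m≤n+m _ _)

term+term≤∑ : ∀ {n} (f : Fin n → ℕ) {i j} → i ≢ j → f i + f j ≤ ∑ f
term+term≤∑ f {zero} {zero} i≢j = ⊥-elim (i≢j refl)
term+term≤∑ f {zero} {suc j} _ = +-monoʳ-≤ (f zero) (term≤∑ (f ∘ suc) j)
term+term≤∑ f {suc i} {zero} _ =
  subst (_≤ ∑ f) (+-comm (f zero) _) (+-monoʳ-≤ (f zero) (term≤∑ (f ∘ suc) i))
term+term≤∑ f {suc i} {suc j} i≢j =
  ≤-trans (term+term≤∑ (f ∘ suc) (i≢j ∘ cong suc)) (m≤n+m _ _)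

∑-*-∑-comm : ∀ {m n} (f : Fin n → ℕ) (g : Fin m → ℕ) (h : Fin m → Fin n → ℕ) →
  ∑[ j < n ] (f j * ∑[ i < m ] (g i * h i j)) ≡ ∑[ i < m ] (g i * ∑[ j < n ] (f j * h i j))
∑-*-∑-comm {m} {n} f g h = begin
  ∑[ j < n ] (f j * ∑[ i < m ] (g i * h i j))
    ≡⟨ sum-cong-≗ (λ j → *-distribˡ-sum (f j) (λ i → g i * h i j)) ⟩
  ∑[ j < n ] ∑[ i < m ] (f j * (g i * h i j))
    ≡⟨ ∑-comm (λ j i → f j * (g i * h i j)) ⟩
  ∑[ i < m ] ∑[ j < n ] (f j * (g i * h i j))
    ≡⟨ sum-cong-≗ (λ i → sum-cong-≗ (λ j → x*[y*z]≡y*[x*z] (f j) (g i) (h i j))) ⟩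
  ∑[ i < m ] ∑[ j < n ] (g i * (f j * h i j))
    ≡⟨ sum-cong-≗ (λ i → *-distribˡ-sum (g i) (λ j → f j * h i j)) ⟨
  ∑[ i < m ] (g i * ∑[ j < n ] (f j * h i j))
    ∎
  where
  open ≡-Reasoning
  x*[y*z]≡y*[x*z] : ∀ x y z → x * (y * z) ≡ y * (x * z)
  x*[y*z]≡y*[x*z] = solve-∀

sum-tabulate : ∀ {n} (f : Fin n → ℕ) → sum (tabulate f) ≡ ∑ f
sum-tabulate {zero} f = refl
sum-tabulate {suc n} f = cong (f zero +_) (sum-tabulate (f ∘ suc))

𝟙 : Bool → ℕ
𝟙 b = if b then 1 else 0

∧≡true : ∀ {x y} → x ∧ y ≡ true → x ≡ true × y ≡ true
∧≡true {true} {true} refl = refl , refl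

𝟙<𝟙 : ∀ {x y} → 𝟙 x < 𝟙 y → x ≡ false × y ≡ true
𝟙<𝟙 {false} {false} ()
𝟙<𝟙 {false} {true} _ = refl , refl
𝟙<𝟙 {true} {false} ()
𝟙<𝟙 {true} {true} (s≤s ())

𝟙-∧ : ∀ x y → 𝟙 x * 𝟙 y ≡ 𝟙 (x ∧ y)
𝟙-∧ true y = +-identityʳ (𝟙 y)
𝟙-∧ false y = refl

∑𝟙≤1 : ∀ {n} (P : Fin n → Bool) → (∀ i j → P i ≡ true → P j ≡ true → i ≡ j) → ∑ (𝟙 ∘ P) ≤ 1
∑𝟙≤1 {zero} P unique = z≤n
∑𝟙≤1 {suc n} P unique with P zero in P0
... | false = ∑𝟙≤1 (P ∘ suc) (λ i j Pi Pj → Fin.suc-injective (unique _ _ Pi Pj))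
... | true = s≤s (≤-reflexive (trans (sum-cong-≗ rest-false) (∑-zero {n})))
  where
  rest-false : ∀ i → 𝟙 (P (suc i)) ≡ 0
  rest-false i with P (suc i) in Pi
  ... | false = refl
  ... | true with () ← unique zero (suc i) P0 Pi

δ : ∀ {n} → Fin n → Fin n → ℕ
δ zero zero = 1
δ zero (suc _) = 0
δ (suc _) zero = 0
δ (suc i) (suc j) = δ i j

δ-refl : ∀ {n} (i : Fin n) → δ i i ≡ 1
δ-refl zero = refl
δ-refl (suc i) = δ-refl i

δ-≢ : ∀ {n} {i j : Fin n} → i ≢ j → δ i j ≡ 0
δ-≢ {i = zero} {zero} i≢j = ⊥-elim (i≢j refl)
δ-≢ {i = zero} {suc j} _ = refl
δ-≢ {i = suc i} {zero} _ = refl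
δ-≢ {i = suc i} {suc j} i≢j = δ-≢ (i≢j ∘ cong suc)

∑-δ : ∀ {n} (i : Fin n) → ∑ (δ i) ≡ 1
∑-δ {suc n} zero = cong suc (∑-zero {n})
∑-δ {suc n} (suc i) = ∑-δ i

module BipartiteBiregular
  {n : ℕ} (A : Adj n) (A-sym : ∀ u v → A u v ≡ A v u)
  (part : Fin n → Bool) (bipartite : ∀ u v → A u v ≡ true → part u ≢ part v)
  (r s : ℕ) (deg-V₁ : ∀ v → part v ≡ true → degree A v ≡ r)
  (deg-V₂ : ∀ v → part v ≡ false → degree A v ≡ s)
  where

  a : Fin n → Fin n → ℕ
  a u v = 𝟙 (A u v)

  t w : Fin n → ℕ
  t v = 𝟙 (part v)
  w v = 𝟙 (not (part v))

  ∣V₁∣ ∣V₂∣ : ℕ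
  ∣V₁∣ = ∑ t
  ∣V₂∣ = ∑ w

  common : Fin n → Fin n → ℕ
  common p q = ∑[ C < n ] (a p C * a C q)

  opposite : ∀ {u v} → A u v ≡ true → part v ≡ not (part u)
  opposite {u} {v} uv = ¬-not (bipartite u v uv ∘ sym)

  V₁-adj⇒V₂ : ∀ {u v} → part u ≡ true → A u v ≡ true → part v ≡ false
  V₁-adj⇒V₂ u∈V₁ uv = trans (opposite uv) (cong not u∈V₁)

  V₂-adj⇒V₁ : ∀ {u v} → part u ≡ false → A u v ≡ true → part v ≡ true
  V₂-adj⇒V₁ u∈V₂ uv = trans (opposite uv) (cong not u∈V₂)

  degree≡∑a : ∀ v → degree A v ≡ ∑ (a v)
  degree≡∑a v = trans (cong sum (map-tabulate (λ x → x) (a v))) (sum-tabulate (a v))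

  ∑a-V₁ : ∀ {v} → part v ≡ true → ∑ (a v) ≡ r
  ∑a-V₁ {v} v∈V₁ = trans (sym (degree≡∑a v)) (deg-V₁ v v∈V₁)

  ∑a-V₂ : ∀ {v} → part v ≡ false → ∑ (a v) ≡ s
  ∑a-V₂ {v} v∈V₂ = trans (sym (degree≡∑a v)) (deg-V₂ v v∈V₂)

  ∣V₁∣+∣V₂∣≡n : ∣V₁∣ + ∣V₂∣ ≡ n
  ∣V₁∣+∣V₂∣≡n = begin
    ∣V₁∣ + ∣V₂∣            ≡⟨ ∑-distrib-+ t w ⟨
    ∑[ v < n ] (t v + w v) ≡⟨ sum-cong-≗ t+w≡1 ⟩
    ∑[ v < n ] 1           ≡⟨ ∑-const {n} 1 ⟩
    n * 1                  ≡⟨ *-identityʳ n ⟩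
    n                      ∎
    where
    open ≡-Reasoning
    t+w≡1 : ∀ v → t v + w v ≡ 1
    t+w≡1 v with part v
    ... | true = refl
    ... | false = refl

  edge-count : ∣V₁∣ * r ≡ ∣V₂∣ * s
  edge-count = begin
    ∣V₁∣ * r                              ≡⟨ *-distribʳ-sum r t ⟩
    ∑[ u < n ] (t u * r)                  ≡⟨ sum-cong-≗ t*∑a ⟨
    ∑[ u < n ] (t u * ∑ (a u))            ≡⟨ sum-cong-≗ (λ u → *-distribˡ-sum (t u) (a u)) ⟩
    ∑[ u < n ] ∑[ v < n ] (t u * a u v)   ≡⟨ ∑-comm (λ u v → t u * a u v) ⟩
    ∑[ v < n ] ∑[ u < n ] (t u * a u v)   ≡⟨ sum-cong-≗ (λ v → sum-cong-≗ (λ u → t*a≡w*a u v)) ⟩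
    ∑[ v < n ] ∑[ u < n ] (w v * a v u)   ≡⟨ sum-cong-≗ (λ v → *-distribˡ-sum (w v) (a v)) ⟨
    ∑[ v < n ] (w v * ∑ (a v))            ≡⟨ sum-cong-≗ w*∑a ⟩
    ∑[ v < n ] (w v * s)                  ≡⟨ *-distribʳ-sum s w ⟨
    ∣V₂∣ * s                              ∎
    where
    open ≡-Reasoning
    t*∑a : ∀ u → t u * ∑ (a u) ≡ t u * r
    t*∑a u with part u in u∈
    ... | true = cong (_+ 0) (∑a-V₁ u∈)
    ... | false = refl
    w*∑a : ∀ u → w u * ∑ (a u) ≡ w u * s
    w*∑a u with part u in u∈
    ... | true = refl
    ... | false = cong (_+ 0) (∑a-V₂ u∈)
    t*a≡w*a : ∀ u v → t u * a u v ≡ w v * a v u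
    t*a≡w*a u v rewrite A-sym v u with A u v in uv
    ... | false = trans (*-zeroʳ (t u)) (sym (*-zeroʳ (w v)))
    ... | true rewrite opposite uv with part u
    ...   | true = refl
    ...   | false = refl

  common-V₂-diag : ∀ {p} → part p ≡ false → common p p ≡ s
  common-V₂-diag {p} p∈V₂ = trans (sum-cong-≗ a*a≡a) (∑a-V₂ p∈V₂)
    where
    a*a≡a : ∀ C → a p C * a C p ≡ a p C
    a*a≡a C rewrite A-sym C p with A p C
    ... | true = refl
    ... | false = refl

  ∑-w*common : ∀ {p} → part p ≡ false → ∑[ q < n ] (w q * common p q) ≡ s * r
  ∑-w*common {p} p∈V₂ = begin
    ∑[ q < n ] (w q * common p q)               ≡⟨ ∑-*-∑-comm w (a p) a ⟩
    ∑[ C < n ] (a p C * ∑[ q < n ] (w q * a C q)) ≡⟨ sum-cong-≗ paths-through ⟩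
    ∑[ C < n ] (a p C * r)                      ≡⟨ *-distribʳ-sum r (a p) ⟨
    ∑ (a p) * r                                 ≡⟨ cong (_* r) (∑a-V₂ p∈V₂) ⟩
    s * r                                       ∎
    where
    open ≡-Reasoning
    w*a≡a : ∀ {C} → part C ≡ true → ∀ q → w q * a C q ≡ a C q
    w*a≡a {C} C∈V₁ q with A C q in Cq
    ... | false = *-zeroʳ (w q)
    ... | true rewrite V₁-adj⇒V₂ C∈V₁ Cq = refl
    paths-through : ∀ C → a p C * ∑[ q < n ] (w q * a C q) ≡ a p C * r
    paths-through C with A p C in pC
    ... | false = refl
    ... | true = cong (_+ 0) (trans (sum-cong-≗ (w*a≡a C∈V₁)) (∑a-V₁ C∈V₁))
      where C∈V₁ = V₂-adj⇒V₁ p∈V₂ pC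

  V₂-nonempty : 0 < ∣V₂∣ → ∃[ p ] part p ≡ false
  V₂-nonempty 0<∣V₂∣ with p , 0<wp ← ∑<∑⇒∃< (λ _ → 0) w (subst (_< ∣V₂∣) (sym (∑-zero {n})) 0<∣V₂∣)
    = p , not-injective (proj₂ (𝟙<𝟙 0<wp))

  V₁-non-neighbour : ∀ {p} → part p ≡ false → s < ∣V₁∣ → ∃[ B ] (part B ≡ true × A p B ≡ false)
  V₁-non-neighbour {p} p∈V₂ s<∣V₁∣
    with B , apB<tB ← ∑<∑⇒∃< (a p) t (subst (_< ∣V₁∣) (sym (∑a-V₂ p∈V₂)) s<∣V₁∣)
    = B , proj₂ (𝟙<𝟙 apB<tB) , proj₁ (𝟙<𝟙 apB<tB)

  module DiameterAtMost3 (diam : ∀ u v → DistLe A 3 u v) where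

    V₂-common-neighbour : ∀ {p q} → part p ≡ false → part q ≡ false → p ≢ q →
                          ∃[ C ] (A p C ≡ true × A C q ≡ true)
    V₂-common-neighbour {p} {q} p∈V₂ q∈V₂ p≢q with diam p q
    ... | _ , _ , here = ⊥-elim (p≢q refl)
    ... | _ , _ , step pq here = ⊥-elim (bipartite p q pq (trans p∈V₂ (sym q∈V₂)))
    ... | _ , _ , step {w = C} pC (step Cq here) = C , pC , Cq
    ... | _ , _ , step {w = C} pC (step {w = D} CD (step Dq here)) =
      ⊥-elim (bipartite D q Dq (trans (V₁-adj⇒V₂ (V₂-adj⇒V₁ p∈V₂ pC) CD) (sym q∈V₂)))
    ... | _ , s≤s (s≤s (s≤s ())) , step _ (step _ (step _ (step _ _)))

    1≤common-V₂ : ∀ {p q} → part p ≡ false → part q ≡ false → p ≢ q → 1 ≤ common p q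
    1≤common-V₂ {p} {q} p∈V₂ q∈V₂ p≢q with V₂-common-neighbour p∈V₂ q∈V₂ p≢q
    ... | C , pC , Cq =
      subst (_≤ common p q) (cong₂ (λ x y → 𝟙 x * 𝟙 y) pC Cq) (term≤∑ (λ D → a p D * a D q) C)

    module MooreTight (tight : s * r + 1 ≡ ∣V₂∣ + s) where

      common-V₂≡1 : ∀ {p q} → part p ≡ false → part q ≡ false → p ≢ q → common p q ≡ 1
      common-V₂≡1 {p} {q} p∈V₂ q∈V₂ p≢q =
        at-q (∑-mono-≤-rigid lower≤upper (≤-reflexive ∑upper≡∑lower) q)
        where
        lower upper : Fin n → ℕ
        lower q = w q + δ p q * s
        upper q = w q * common p q + δ p q
        lower≤upper : ∀ q → lower q ≤ upper q
        lower≤upper q with p ≟ᶠ q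
        ... | yes refl rewrite δ-refl p | p∈V₂ | common-V₂-diag p∈V₂ = ≤-reflexive (+-comm 1 (s + 0))
        ... | no p≢q rewrite δ-≢ p≢q with part q in q∈
        ...   | true = z≤n
        ...   | false = +-monoˡ-≤ 0 (≤-trans (1≤common-V₂ p∈V₂ q∈ p≢q) (≤-reflexive (sym (+-identityʳ _))))
        ∑upper≡∑lower : ∑ upper ≡ ∑ lower
        ∑upper≡∑lower = begin
          ∑ upper                                    ≡⟨ ∑-distrib-+ (λ q → w q * common p q) (δ p) ⟩
          ∑[ q < n ] (w q * common p q) + ∑ (δ p)    ≡⟨ cong₂ _+_ (∑-w*common p∈V₂) (∑-δ p) ⟩
          s * r + 1                                  ≡⟨ tight ⟩
          ∣V₂∣ + s                                   ≡⟨ cong (∣V₂∣ +_) (*-identityˡ s) ⟨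
          ∣V₂∣ + 1 * s                               ≡⟨ cong (λ x → ∣V₂∣ + x * s) (∑-δ p) ⟨
          ∣V₂∣ + ∑ (δ p) * s                         ≡⟨ cong (∣V₂∣ +_) (*-distribʳ-sum s (δ p)) ⟩
          ∣V₂∣ + ∑[ q < n ] (δ p q * s)              ≡⟨ ∑-distrib-+ w (λ q → δ p q * s) ⟨
          ∑ lower                                    ∎
          where open ≡-Reasoning
        at-q : lower q ≡ upper q → common p q ≡ 1
        at-q lower≡upper rewrite δ-≢ p≢q | q∈V₂ =
          sym (trans lower≡upper (trans (+-identityʳ _) (*-identityˡ _)))

      shared-V₁≤1 : ∀ {B C} → part B ≡ true → B ≢ C → ∑[ q < n ] (a B q * a C q) ≤ 1
      shared-V₁≤1 {B} {C} B∈V₁ B≢C =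
        subst (_≤ 1) (sum-cong-≗ (λ q → sym (𝟙-∧ (A B q) (A C q)))) (∑𝟙≤1 (λ q → A B q ∧ A C q) unique)
        where
        unique : ∀ q q' → A B q ∧ A C q ≡ true → A B q' ∧ A C q' ≡ true → q ≡ q'
        unique q q' BCq BCq' with q ≟ᶠ q' | ∧≡true BCq | ∧≡true BCq'
        ... | yes q≡q' | _ | _ = q≡q'
        ... | no q≢q' | Bq , Cq | Bq' , Cq' = ⊥-elim (1+n≰n (begin
          2                                 ≡⟨ cong₂ _+_ (paths-via Bq Bq') (paths-via Cq Cq') ⟨
          a q B * a B q' + a q C * a C q'   ≤⟨ term+term≤∑ (λ D → a q D * a D q') B≢C ⟩
          common q q'                       ≡⟨ common-V₂≡1 (V₁-adj⇒V₂ B∈V₁ Bq) (V₁-adj⇒V₂ B∈V₁ Bq') q≢q' ⟩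
          1                                 ∎))
          where
          open ≤-Reasoning
          paths-via : ∀ {D} → A D q ≡ true → A D q' ≡ true → a q D * a D q' ≡ 1
          paths-via {D} Dq Dq' = cong₂ (λ x y → 𝟙 x * 𝟙 y) (trans (A-sym q D) Dq) Dq'

      non-adjacent⇒r≤s : ∀ {p B} → part p ≡ false → part B ≡ true → A p B ≡ false → r ≤ s
      non-adjacent⇒r≤s {p} {B} p∈V₂ B∈V₁ p≁B = begin
        r                                                 ≡⟨ ∑a-V₁ B∈V₁ ⟨
        ∑ (a B)                                           ≡⟨ sum-cong-≗ a*common≡a ⟨
        ∑[ q < n ] (a B q * common p q)                   ≡⟨ ∑-*-∑-comm (a B) (a p) a ⟩
        ∑[ C < n ] (a p C * ∑[ q < n ] (a B q * a C q))   ≤⟨ ∑-mono-≤ a*shared≤a ⟩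
        ∑ (a p)                                           ≡⟨ ∑a-V₂ p∈V₂ ⟩
        s                                                 ∎
        where
        open ≤-Reasoning
        a*common≡a : ∀ q → a B q * common p q ≡ a B q
        a*common≡a q with A B q in Bq
        ... | false = refl
        ... | true = trans (+-identityʳ _) (common-V₂≡1 p∈V₂ (V₁-adj⇒V₂ B∈V₁ Bq) p≢q)
          where
          p≢q : p ≢ q
          p≢q refl with () ← trans (sym p≁B) (trans (A-sym p B) Bq)
        a*shared≤a : ∀ C → a p C * ∑[ q < n ] (a B q * a C q) ≤ a p C
        a*shared≤a C with A p C in pC
        ... | false = z≤n
        ... | true = ≤-trans (≤-reflexive (+-identityʳ _)) (shared-V₁≤1 B∈V₁ B≢C)
          where
          B≢C : B ≢ C
          B≢C refl with () ← trans (sym p≁B) pC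

      r≤s : s < ∣V₁∣ → 0 < ∣V₂∣ → r ≤ s
      r≤s s<∣V₁∣ 0<∣V₂∣ with p , p∈V₂ ← V₂-nonempty 0<∣V₂∣
        with B , B∈V₁ , p≁B ← V₁-non-neighbour p∈V₂ s<∣V₁∣
        = non-adjacent⇒r≤s p∈V₂ B∈V₁ p≁B

2*[1+m]∸1 : ∀ m → 2 * (1 + m) ∸ 1 ≡ 1 + 2 * m
2*[1+m]∸1 m = +-suc m (m + 0)

odd⇒≡1+2k : ∀ s → s % 2 ≡ 1 → ∃[ k ] s ≡ 1 + 2 * k
odd⇒≡1+2k s s-odd = s / 2 , trans (m≡m%n+[m/n]*n s 2) (cong₂ _+_ s-odd (*-comm (s / 2) 2))

-- M(2s,s;3) = 3 · M/3 s
M/3 : ℕ → ℕ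
M/3 s = (1 + s * (2 * s ∸ 1)) / 2

M/3-odd : ∀ k → M/3 (1 + 2 * k) ≡ 1 + 3 * k + 4 * (k * k)
M/3-odd k = begin
  (1 + (1 + 2 * k) * (2 * (1 + 2 * k) ∸ 1)) / 2 ≡⟨ cong (λ x → (1 + (1 + 2 * k) * x) / 2) (2*[1+m]∸1 (2 * k)) ⟩
  (1 + (1 + 2 * k) * (1 + 2 * (2 * k))) / 2     ≡⟨ cong (_/ 2) (numerator k) ⟩
  (1 + 3 * k + 4 * (k * k)) * 2 / 2             ≡⟨ m*n/n≡m _ 2 ⟩
  1 + 3 * k + 4 * (k * k)                       ∎
  where
  open ≡-Reasoning
  numerator : ∀ k → 1 + (1 + 2 * k) * (1 + 2 * (2 * k)) ≡ (1 + 3 * k + 4 * (k * k)) * 2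
  numerator = solve-∀

M/3-tight : ∀ s → s % 2 ≡ 1 → s * (2 * s) + 1 ≡ 2 * M/3 s + s
M/3-tight s s-odd with k , refl ← odd⇒≡1+2k s s-odd rewrite M/3-odd k = identity k
  where
  identity : ∀ k → (1 + 2 * k) * (2 * (1 + 2 * k)) + 1 ≡ 2 * (1 + 3 * k + 4 * (k * k)) + (1 + 2 * k)
  identity = solve-∀

<M/3 : ∀ {s} → 3 ≤ s → s % 2 ≡ 1 → s < M/3 s
<M/3 {s} 3≤s s-odd with k , refl ← odd⇒≡1+2k s s-odd rewrite M/3-odd k =
  subst (1 + 2 * k <_) (sym (split k)) (m<m+n (1 + 2 * k) (≤-trans (1≤k k 3≤s) (m≤m+n k _)))
  where
  split : ∀ k → 1 + 3 * k + 4 * (k * k) ≡ (1 + 2 * k) + (k + 4 * (k * k))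
  split = solve-∀
  1≤k : ∀ k → 3 ≤ 1 + 2 * k → 1 ≤ k
  1≤k zero (s≤s ())
  1≤k (suc k) _ = s≤s z≤n

one-third-two-thirds : ∀ {x y m} s .{{_ : NonZero s}} → x * (2 * s) ≡ y * s → x + y ≡ 3 * m →
                       x ≡ m × y ≡ 2 * m
one-third-two-thirds {x} {y} {m} s x*2s≡y*s x+y≡3m = x≡m , trans y≡2x (cong (2 *_) x≡m)
  where
  y≡2x : y ≡ 2 * x
  y≡2x = *-cancelʳ-≡ y (2 * x) s (trans (sym x*2s≡y*s) (x*[2*s]≡[2*x]*s x s))
    where
    x*[2*s]≡[2*x]*s : ∀ x s → x * (2 * s) ≡ 2 * x * s
    x*[2*s]≡[2*x]*s = solve-∀
  x≡m : x ≡ m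
  x≡m = *-cancelˡ-≡ x m 3 (begin
    3 * x      ≡⟨ 3*x≡x+2*x x ⟩
    x + 2 * x  ≡⟨ cong (x +_) y≡2x ⟨
    x + y      ≡⟨ x+y≡3m ⟩
    3 * m      ∎)
    where
    open ≡-Reasoning
    3*x≡x+2*x : ∀ x → 3 * x ≡ x + 2 * x
    3*x≡x+2*x = solve-∀

corollary2p4 : (s : ℕ) → 3 ≤ s → s % 2 ≡ 1 →
    ¬ (∃[ n ] ∃[ A ] (IsSimple {n} A × IsBiregular A (2 * s) s × HasDiameter A 3
                      × n ≡ 3 * ((1 + s * (2 * s ∸ 1)) / 2)))
corollary2p4 s 3≤s s-odd (n , A , (A-sym , _) , (part , bipartite , deg-V₁ , deg-V₂) , (diam , _) , n≡3m) =
  1+n≰n (*-cancelʳ-≤ 2 1 s (subst (2 * s ≤_) (sym (*-identityˡ s)) 2s≤s))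
  where
  open BipartiteBiregular A A-sym part bipartite (2 * s) s deg-V₁ deg-V₂
  instance
    s≢0 : NonZero s
    s≢0 = >-nonZero (≤-trans (s≤s z≤n) 3≤s)
  m : ℕ
  m = M/3 s
  s<m : s < m
  s<m = <M/3 3≤s s-odd
  sizes : ∣V₁∣ ≡ m × ∣V₂∣ ≡ 2 * m
  sizes = one-third-two-thirds s edge-count (trans ∣V₁∣+∣V₂∣≡n n≡3m)
  open DiameterAtMost3 diam
  open MooreTight (trans (M/3-tight s s-odd) (cong (_+ s) (sym (proj₂ sizes))))
  2s≤s : 2 * s ≤ s
  2s≤s = r≤s (subst (s <_) (sym (proj₁ sizes)) s<m)
             (subst (0 <_) (sym (proj₂ sizes)) (<-≤-trans (≤-<-trans z≤n s<m) (m≤m+n m (m + 0))))
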